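{- Let $a,b\in 6\mathbb{N}_0$ with $a\ge b$ be vertices of $\mathcal{G}_\infty$. If $a$ and $b$ are adjacent in $\mathcal{G}_\infty$, then $a=6$ and $b=0$.
   Context: Let $\mathcal{P}$ be the set of odd primes and $\mathbb{N}_0=\{0,1,2,\dots\}$, so $6\mathbb{N}_0=\{0,6,12,\dots\}$. $\mathcal{G}_\infty$ is the simple undirected graph whose vertex set is the set of non-negative even integers, in which distinct $a,b$ are adjacent iff $\frac{a+b}{2}\in\mathcal{P}$ and $\frac{|a-b|}{2}\in\mathcal{P}$. -}

module Defs where

open import Data.Nat using (ℕ; _+_; _*_; _/_; ∣_-_∣)
open import Data.Nat.Divisibility using (_∣_)
open import Data.Nat.Primality using (Prime)
open import Data.Product using (_×_)
open import Relation.Nullary using (¬_)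
open import Relation.Binary.PropositionalEquality using (_≡_)

OddPrime : ℕ → Set
OddPrime p = Prime p × ¬ (2 ∣ p)

Vertex : ℕ → Set
Vertex a = 2 ∣ a

In6N0 : ℕ → Set
In6N0 a = 6 ∣ a

-- adjacency in 𝒢∞ (for even a, b the divisions by 2 are exact)
Adj : ℕ → ℕ → Set
Adj a b = ¬ (a ≡ b) × OddPrime ((a + b) / 2) × OddPrime (∣ a - b ∣ / 2)

-- Write a = 6m and b = 6n.  Then (a + b)/2 = 3(m + n) is prime only if m + n = 1,
-- and a ≥ b forces m = 1, n = 0.
module Submission where

open import Defs
open import Data.Nat using (ℕ; zero; suc; _+_; _*_; _/_; _≤_; _≥_)
open import Data.Nat.Properties using (*-cancelˡ-≡; *-cancelʳ-≤; *-identityʳ)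
open import Data.Nat.DivMod using (m*n/n≡m)
open import Data.Nat.Divisibility using (divides; m∣m*n)
open import Data.Nat.Primality using (Prime; prime⇒irreducible; prime⇒nonZero)
open import Data.Nat.Solver using (module +-*-Solver)
open import Data.Product using (_×_; _,_)
open import Data.Sum using (inj₁; inj₂)
open import Data.Empty using (⊥-elim)
open import Relation.Binary.PropositionalEquality
  using (_≡_; _≢_; refl; sym; trans; cong; subst)

*6+*6/2≡+*3 : ∀ m n → (m * 6 + n * 6) / 2 ≡ (m + n) * 3
*6+*6/2≡+*3 m n = trans (cong (_/ 2) double) (m*n/n≡m ((m + n) * 3) 2)
  where
  open +-*-Solver
  double : m * 6 + n * 6 ≡ (m + n) * 3 * 2
  double = solve 2 (λ m n → m :* con 6 :+ n :* con 6 := (m :+ n) :* con 3 :* con 2) refl m n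

prime-*ʳ⇒≡1 : ∀ k {d} → d ≢ 1 → Prime (k * d) → k ≡ 1
prime-*ʳ⇒≡1 zero _ p with prime⇒nonZero p
... | ()
prime-*ʳ⇒≡1 (suc k) {d} d≢1 p with prime⇒irreducible p (m∣m*n d)
... | inj₁ k≡1   = k≡1
... | inj₂ k≡k*d = ⊥-elim (d≢1 (sym (*-cancelˡ-≡ 1 d (suc k) (trans (*-identityʳ (suc k)) k≡k*d))))

+≡1∧≤⇒≡1,0 : ∀ m n → n ≤ m → m + n ≡ 1 → m ≡ 1 × n ≡ 0
+≡1∧≤⇒≡1,0 (suc zero) zero    _ _  = refl , refl
+≡1∧≤⇒≡1,0 zero       zero    _ ()
+≡1∧≤⇒≡1,0 (suc zero) (suc n) _ ()
+≡1∧≤⇒≡1,0 (suc (suc m)) n    _ ()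

mainTheorem12 : (a b : ℕ) → Vertex a → Vertex b → In6N0 a → In6N0 b → a ≥ b →
    Adj a b → (a ≡ 6) × (b ≡ 0)
mainTheorem12 _ _ _ _ (divides m refl) (divides n refl) b≤a (_ , (sum-prime , _) , _)
  with +≡1∧≤⇒≡1,0 m n n≤m m+n≡1
  where
  n≤m : n ≤ m
  n≤m = *-cancelʳ-≤ n m 6 b≤a
  m+n≡1 : m + n ≡ 1
  m+n≡1 = prime-*ʳ⇒≡1 (m + n) (λ ()) (subst Prime (*6+*6/2≡+*3 m n) sum-prime)
... | refl , refl = refl , refl
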